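{- Let $D$ be a sink-free digraph and $K$ a kernel of $D$. Then (1) $K$ is a good quasi-kernel of $D$; and (2) $D$ has a quasi-kernel of size at most $|V(D)|/2$.
   Context: A kernel of a digraph $D$ is an independent set $K\subseteq V(D)$ such that every vertex of $V(D)\setminus K$ has an arc to some vertex of $K$. A quasi-kernel is an independent set $Q\subseteq V(D)$ such that for every vertex $v\in V(D)\setminus Q$ there is a directed path with one or two arcs from $v$ to some vertex of $Q$. A quasi-kernel $Q$ is good if for each $u\in Q$ there is an arc from $u$ to a vertex which is an in-neighbour of some vertex of $Q$. $D$ is sink-free if every vertex has an out-neighbour. -}

module Defs where

open import Data.Nat using (ℕ)
open import Data.Fin using (Fin)
open import Data.Fin.Subset using (Subset; _∈_; _∉_)
open import Data.Product using (Σ; ∃; _×_)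
open import Data.Sum using (_⊎_)
open import Relation.Nullary using (¬_)
open import Level using (Level; suc; _⊔_)

record Digraph (n : ℕ) : Set₁ where
  field
    Arc      : Fin n → Fin n → Set
    loopless : ∀ v → ¬ Arc v v
open Digraph public

module _ {n : ℕ} (D : Digraph n) where

  Independent : Subset n → Set
  Independent S = ∀ u v → u ∈ S → v ∈ S → ¬ Arc D u v

  SinkFree : Set
  SinkFree = ∀ v → ∃ λ w → Arc D v w

  IsKernel : Subset n → Set
  IsKernel K = Independent K × (∀ v → v ∉ K → ∃ λ w → w ∈ K × Arc D v w)

  Reach≤2 : Fin n → Fin n → Set
  Reach≤2 v w = Arc D v w ⊎ (∃ λ x → Arc D v x × Arc D x w)

  IsQuasiKernel : Subset n → Set
  IsQuasiKernel Q = Independent Q × (∀ v → v ∉ Q → ∃ λ w → w ∈ Q × Reach≤2 v w)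

  IsGoodQuasiKernel : Subset n → Set
  IsGoodQuasiKernel Q =
    IsQuasiKernel Q × (∀ u → u ∈ Q → ∃ λ x → Arc D u x × (∃ λ w → w ∈ Q × Arc D x w))

{-# OPTIONS --safe #-}
module Submission where

-- The kernel K absorbs every outside vertex in one step, and a vertex u of K
-- reaches the outside in one step (D is sink-free and K independent), hence
-- reaches K in two; this makes K a good quasi-kernel. For the size bound,
-- choose for each vertex outside K one out-neighbour in K: the chosen set
-- Q ⊆ K is independent, absorbs V ∖ K in one step and K ∖ Q in two, and
-- 2∣Q∣ ≤ ∣K∣ + ∣V ∖ K∣ = n.

open import Defs
open import Data.Nat using (ℕ; _*_; _≤_; _+_; s≤s)
open import Data.Nat.Properties using (≤-refl; ≤-trans; +-mono-≤; +-suc; m≤n⇒m≤1+n; m+[n∸m]≡n; +-identityʳ; module ≤-Reasoning)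
open import Data.Fin using (Fin; zero; suc)
open import Data.Fin.Subset using (Subset; ∣_∣; _∈_; _∉_; _⊆_; ⊥; ⁅_⁆; _∪_; ∁; inside; outside)
open import Data.Fin.Subset.Properties using (_∈?_; ∉⊥; ∣⊥∣≡0; x∈⁅x⁆; x∈⁅y⁆⇒x≡y; x∈p∪q⁺; x∈p∪q⁻; ∣⁅x⁆∣≡1; ∣p∣≤n; ∣∁p∣≡n∸∣p∣; p⊆q⇒∣p∣≤∣q∣; x∉p⇒x∈∁p; x∈∁p⇒x∉p)
open import Data.Vec using ([]; _∷_; here; there)
open import Data.Product using (∃; _×_; _,_; proj₁; proj₂)
open import Data.Sum using (inj₁; inj₂)
open import Function using (_∘_)
open import Relation.Nullary using (yes; no; contradiction)
open import Relation.Binary.PropositionalEquality using (_≡_; refl; cong; sym; subst)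

∣p∪q∣≤∣p∣+∣q∣ : ∀ {n} (p q : Subset n) → ∣ p ∪ q ∣ ≤ ∣ p ∣ + ∣ q ∣
∣p∪q∣≤∣p∣+∣q∣ []            []            = ≤-refl
∣p∪q∣≤∣p∣+∣q∣ (inside  ∷ p) (inside  ∷ q) = s≤s (≤-trans (∣p∪q∣≤∣p∣+∣q∣ p q) (+-mono-≤ ≤-refl (m≤n⇒m≤1+n ≤-refl)))
∣p∪q∣≤∣p∣+∣q∣ (inside  ∷ p) (outside ∷ q) = s≤s (∣p∪q∣≤∣p∣+∣q∣ p q)
∣p∪q∣≤∣p∣+∣q∣ (outside ∷ p) (inside  ∷ q) = subst (∣ (outside ∷ p) ∪ (inside ∷ q) ∣ ≤_) (sym (+-suc ∣ p ∣ ∣ q ∣)) (s≤s (∣p∪q∣≤∣p∣+∣q∣ p q))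
∣p∪q∣≤∣p∣+∣q∣ (outside ∷ p) (outside ∷ q) = ∣p∪q∣≤∣p∣+∣q∣ p q

image : ∀ {m n} → (Fin m → Fin n) → Subset m → Subset n
image f []            = ⊥
image f (inside  ∷ p) = ⁅ f zero ⁆ ∪ image (f ∘ suc) p
image f (outside ∷ p) = image (f ∘ suc) p

∣image∣≤∣p∣ : ∀ {m n} (f : Fin m → Fin n) (p : Subset m) → ∣ image f p ∣ ≤ ∣ p ∣
∣image∣≤∣p∣ {n = n} f []    = subst (_≤ 0) (sym (∣⊥∣≡0 n)) ≤-refl
∣image∣≤∣p∣ f (inside  ∷ p) = begin
  ∣ ⁅ f zero ⁆ ∪ image (f ∘ suc) p ∣       ≤⟨ ∣p∪q∣≤∣p∣+∣q∣ ⁅ f zero ⁆ (image (f ∘ suc) p) ⟩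
  ∣ ⁅ f zero ⁆ ∣ + ∣ image (f ∘ suc) p ∣   ≡⟨ cong (_+ ∣ image (f ∘ suc) p ∣) (∣⁅x⁆∣≡1 (f zero)) ⟩
  1 + ∣ image (f ∘ suc) p ∣                ≤⟨ s≤s (∣image∣≤∣p∣ (f ∘ suc) p) ⟩
  1 + ∣ p ∣                                ∎
  where open ≤-Reasoning
∣image∣≤∣p∣ f (outside ∷ p) = ∣image∣≤∣p∣ (f ∘ suc) p

x∈p⇒fx∈image : ∀ {m n} {f : Fin m → Fin n} {p : Subset m} {x} → x ∈ p → f x ∈ image f p
x∈p⇒fx∈image {f = f} here = x∈p∪q⁺ (inj₁ (x∈⁅x⁆ (f zero)))
x∈p⇒fx∈image {p = inside  ∷ p} (there x∈p) = x∈p∪q⁺ (inj₂ (x∈p⇒fx∈image x∈p))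
x∈p⇒fx∈image {p = outside ∷ p} (there x∈p) = x∈p⇒fx∈image x∈p

y∈image⇒preimage : ∀ {m n} {f : Fin m → Fin n} {p : Subset m} {y} →
                   y ∈ image f p → ∃ λ x → x ∈ p × f x ≡ y
y∈image⇒preimage {p = []} y∈⊥ = contradiction y∈⊥ ∉⊥
y∈image⇒preimage {f = f} {p = inside ∷ p} y∈ with x∈p∪q⁻ ⁅ f zero ⁆ (image (f ∘ suc) p) y∈
... | inj₁ y∈⁅fzero⁆ = zero , here , sym (x∈⁅y⁆⇒x≡y _ y∈⁅fzero⁆)
... | inj₂ y∈image with y∈image⇒preimage y∈image
...   | x , x∈p , fx≡y = suc x , there x∈p , fx≡y
y∈image⇒preimage {p = outside ∷ p} y∈ with y∈image⇒preimage y∈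
... | x , x∈p , fx≡y = suc x , there x∈p , fx≡y

module _ {n} {B K : Subset n} {R : Fin n → Fin n → Set}
         (absorbed : ∀ b → b ∈ B → ∃ λ w → w ∈ K × R b w) where

  private
    choice : Fin n → Fin n
    choice b with b ∈? B
    ... | yes b∈B = proj₁ (absorbed b b∈B)
    ... | no  _   = b

    choice-absorbs : ∀ b → b ∈ B → choice b ∈ K × R b (choice b)
    choice-absorbs b b∈B with b ∈? B
    ... | yes b∈B′ = proj₂ (absorbed b b∈B′)
    ... | no  b∉B  = contradiction b∈B b∉B

    image⊆K : image choice B ⊆ K
    image⊆K y∈ with y∈image⇒preimage {f = choice} y∈
    ... | x , x∈B , refl = proj₁ (choice-absorbs x x∈B)

  small-absorbing-subset : ∃ λ Q → Q ⊆ K × ∣ Q ∣ ≤ ∣ B ∣ × (∀ b → b ∈ B → ∃ λ q → q ∈ Q × R b q)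
  small-absorbing-subset =
    image choice B , image⊆K , ∣image∣≤∣p∣ choice B ,
    λ b b∈B → choice b , x∈p⇒fx∈image b∈B , proj₂ (choice-absorbs b b∈B)

∣p∣+∣∁p∣≡n : ∀ {n} (p : Subset n) → ∣ p ∣ + ∣ ∁ p ∣ ≡ n
∣p∣+∣∁p∣≡n p = subst (λ c → ∣ p ∣ + c ≡ _) (sym (∣∁p∣≡n∸∣p∣ p)) (m+[n∸m]≡n (∣p∣≤n p))

p⊆q∧∣p∣≤∣∁q∣⇒2∣p∣≤n : ∀ {n} {p q : Subset n} → p ⊆ q → ∣ p ∣ ≤ ∣ ∁ q ∣ → 2 * ∣ p ∣ ≤ n
p⊆q∧∣p∣≤∣∁q∣⇒2∣p∣≤n {n} {p} {q} p⊆q ∣p∣≤∣∁q∣ = begin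
  2 * ∣ p ∣          ≡⟨ cong (∣ p ∣ +_) (+-identityʳ ∣ p ∣) ⟩
  ∣ p ∣ + ∣ p ∣      ≤⟨ +-mono-≤ (p⊆q⇒∣p∣≤∣q∣ p⊆q) ∣p∣≤∣∁q∣ ⟩
  ∣ q ∣ + ∣ ∁ q ∣    ≡⟨ ∣p∣+∣∁p∣≡n q ⟩
  n                  ∎
  where open ≤-Reasoning

module _ {n} (D : Digraph n) where

  ⊆-Independent : ∀ {Q K} → Q ⊆ K → Independent D K → Independent D Q
  ⊆-Independent Q⊆K indK u v u∈Q v∈Q = indK u v (Q⊆K u∈Q) (Q⊆K v∈Q)

  Independent⇒out-neighbour∉ : ∀ {K} → Independent D K → ∀ {u x} → u ∈ K → Arc D u x → x ∉ K
  Independent⇒out-neighbour∉ indK u∈K ux x∈K = indK _ _ u∈K x∈K ux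

  kernel⇒goodQuasiKernel : SinkFree D → ∀ {K} → IsKernel D K → IsGoodQuasiKernel D K
  kernel⇒goodQuasiKernel sinkFree (indK , absorbK) =
    (indK , λ v v∉K → let w , w∈K , vw = absorbK v v∉K in w , w∈K , inj₁ vw) ,
    λ u u∈K → let x , ux = sinkFree u in
              x , ux , absorbK x (Independent⇒out-neighbour∉ indK u∈K ux)

  ⊆-kernel-absorbing-∁⇒quasiKernel :
    SinkFree D → ∀ {K Q} → IsKernel D K → Q ⊆ K →
    (∀ v → v ∉ K → ∃ λ q → q ∈ Q × Arc D v q) → IsQuasiKernel D Q
  ⊆-kernel-absorbing-∁⇒quasiKernel sinkFree {K} {Q} (indK , _) Q⊆K absorbQ =
    ⊆-Independent Q⊆K indK , absorb
    where
    absorb : ∀ v → v ∉ Q → ∃ λ q → q ∈ Q × Reach≤2 D v q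
    absorb v _ with v ∈? K
    ... | no  v∉K = let q , q∈Q , vq = absorbQ v v∉K in q , q∈Q , inj₁ vq
    ... | yes v∈K = let x , vx = sinkFree v
                        q , q∈Q , xq = absorbQ x (Independent⇒out-neighbour∉ indK v∈K vx)
                    in q , q∈Q , inj₂ (x , vx , xq)

corollary1 : ∀ {n : ℕ} (D : Digraph n) → SinkFree D → (K : Subset n) → IsKernel D K →
    IsGoodQuasiKernel D K × (∃ λ (Q : Subset n) → IsQuasiKernel D Q × 2 * ∣ Q ∣ ≤ n)
corollary1 D sinkFree K kernel@(_ , absorbK)
  with small-absorbing-subset {B = ∁ K} (λ v v∈∁K → absorbK v (x∈∁p⇒x∉p v∈∁K))
... | Q , Q⊆K , ∣Q∣≤∣∁K∣ , absorbQ =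
  kernel⇒goodQuasiKernel D sinkFree kernel ,
  Q , ⊆-kernel-absorbing-∁⇒quasiKernel D sinkFree kernel Q⊆K (λ v v∉K → absorbQ v (x∉p⇒x∈∁p v∉K)) ,
      p⊆q∧∣p∣≤∣∁q∣⇒2∣p∣≤n Q⊆K ∣Q∣≤∣∁K∣
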